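{- For $n\ge1$ and integer $k$, let $a_{n,k}$ be the number of $e\in\mathbf{I}_n(\underline{>,\geq})$ with $e_n=k$, let $a^>_{n,k}$ be the number of those that additionally satisfy $e_{n-1}>e_n$, and let $a_n=|\mathbf{I}_n(\underline{>,\geq})|$. Then for $n\ge2$, $$a_{n,k}=\begin{cases}a_{n-1} & \text{if } k=n-1,\\ a_{n,k+1}-a^>_{n-1,k} & \text{if } 0\le k\le n-2,\\ 0&\text{otherwise,}\end{cases}$$ $$a^>_{n,k}=\begin{cases}a^>_{n,k+1}-a^>_{n-1,k+1}+a_{n-1,k+1} & \text{if } 0\le k\le n-2,\\ 0 & \text{otherwise,}\end{cases}$$ with initial conditions $a_1=a_{1,0}=1$, $a_{1,k}=0$ for $k>0$, and $a^>_{1,k}=0$ for all $k$.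
   Context: An inversion sequence of length $n$ is an integer sequence $e=e_1\dots e_n$ with $0\le e_i<i$ for all $i$; $\mathbf{I}_n$ is the set of these. $\mathbf{I}_n(\underline{>,\geq})$ is the set of $e\in\mathbf{I}_n$ with no index $i$ such that $e_i>e_{i+1}\ge e_{i+2}$. -}

module Defs where

open import Data.Nat using (ℕ; zero; suc; _<_; _>_; _≥_)
open import Data.Nat.Properties using (_<?_; _≤?_)
open import Data.Integer using (ℤ; +_)
import Data.Integer as ℤ
open import Data.Fin using (Fin; toℕ)
open import Data.Fin.Properties using (all?)
open import Data.Vec using (Vec; []; _∷_; lookup; toList)
open import Data.List using (List; []; _∷_; [_]; map; concatMap; upTo; length; filter)
open import Data.Product using (_×_; _,_)
open import Data.Sum using (_⊎_; inj₁; inj₂)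
open import Data.Empty using (⊥)
open import Relation.Nullary using (Dec; yes; no; ¬_)
open import Relation.Nullary.Decidable using (_×-dec_; _⊎-dec_; ¬?)
open import Relation.Binary.PropositionalEquality using (_≡_)

-- All vectors of length n with entries in {0, …, b-1} (a finite superset
-- of the inversion sequences of length n when b = n).
allVecs : (n b : ℕ) → List (Vec ℕ n)
allVecs zero    b = [ [] ]
allVecs (suc n) b = concatMap (λ x → map (x ∷_) (allVecs n b)) (upTo b)

-- e is an inversion sequence: 0 ≤ e_i < i (1-indexed), i.e. entry at
-- 0-based position i is < i+1.
IsInvSeq : ∀ {n} → Vec ℕ n → Set
IsInvSeq {n} e = (i : Fin n) → lookup e i < suc (toℕ i)

isInvSeq? : ∀ {n} (e : Vec ℕ n) → Dec (IsInvSeq e)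
isInvSeq? e = all? (λ i → lookup e i <? suc (toℕ i))

-- Consecutive occurrence of the pattern (>,≥): some i with e_i > e_{i+1} ≥ e_{i+2}.
Occ : List ℕ → Set
Occ (x ∷ y ∷ z ∷ r) = (x > y × y ≥ z) ⊎ Occ (y ∷ z ∷ r)
Occ _ = ⊥

occ? : (l : List ℕ) → Dec (Occ l)
occ? (x ∷ y ∷ z ∷ r) = ((y <? x) ×-dec (z ≤? y)) ⊎-dec occ? (y ∷ z ∷ r)
occ? [] = no (λ ())
occ? (_ ∷ []) = no (λ ())
occ? (_ ∷ _ ∷ []) = no (λ ())

InI : ∀ {n} → Vec ℕ n → Set
InI e = IsInvSeq e × ¬ Occ (toList e)

inI? : ∀ {n} (e : Vec ℕ n) → Dec (InI e)
inI? e = isInvSeq? e ×-dec ¬? (occ? (toList e))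

LastIs : ℤ → List ℕ → Set
LastIs k []          = ⊥
LastIs k (x ∷ [])    = + x ≡ k
LastIs k (_ ∷ y ∷ r) = LastIs k (y ∷ r)

lastIs? : (k : ℤ) (l : List ℕ) → Dec (LastIs k l)
lastIs? k []          = no (λ ())
lastIs? k (x ∷ [])    = (+ x) ℤ.≟ k
lastIs? k (_ ∷ y ∷ r) = lastIs? k (y ∷ r)

LastDesc : List ℕ → Set
LastDesc (x ∷ y ∷ []) = x > y
LastDesc (_ ∷ y ∷ z ∷ r) = LastDesc (y ∷ z ∷ r)
LastDesc _ = ⊥

lastDesc? : (l : List ℕ) → Dec (LastDesc l)
lastDesc? (x ∷ y ∷ []) = y <? x
lastDesc? (_ ∷ y ∷ z ∷ r) = lastDesc? (y ∷ z ∷ r)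
lastDesc? [] = no (λ ())
lastDesc? (_ ∷ []) = no (λ ())

a : ℕ → ℕ
a n = length (filter inI? (allVecs n n))

aNK : ℕ → ℤ → ℕ
aNK n k = length (filter (λ e → inI? e ×-dec lastIs? k (toList e)) (allVecs n n))

aGtNK : ℕ → ℤ → ℕ
aGtNK n k = length (filter (λ e → (inI? e ×-dec lastIs? k (toList e)) ×-dec lastDesc? (toList e)) (allVecs n n))

module Submission where

-- Write a sequence of length N = M+1 ending in j as q ∷ʳ j.  It lies
-- in I_N(>,≥) exactly when q ∈ I_M(>,≥), j ≤ M, and q does not end in a
-- descent q_{M-1} > q_M with q_M ≥ j; it ends in a descent exactly when
-- j < q_M.  So a_{N,j} counts the prefixes q that are "extendable by j" and
-- a^>_{N,j} the prefixes with no final descent and q_M > j.  As j grows by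
-- one, the extendable prefixes gain those ending in a descent with q_M = j
-- (counted by a^>_{M,j}); the second family loses those with no final
-- descent and q_M = j+1 (counted by a_{M,j+1} - a^>_{M,j+1}).  At j = M
-- every prefix is extendable, since q_M < M.

module Counting where
  open import Data.Nat using (ℕ; suc; _+_)
  open import Data.Nat.Properties using (+-suc; +-identityʳ)
  open import Data.Nat.ListAction using (sum)
  open import Data.List using (List; []; _∷_; map; concatMap; length; filter; _++_)
  open import Data.List.Properties using (length-++; filter-++; filter-none)
  open import Data.List.Relation.Unary.All as All using (All; []; _∷_)
  open import Data.List.Relation.Unary.Any using (here; there)
  open import Data.List.Relation.Unary.AllPairs using (_∷_)
  open import Data.List.Relation.Unary.Unique.Propositional using (Unique)
  open import Data.List.Membership.Propositional using (_∈_)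
  open import Data.Sum using (_⊎_; inj₁; inj₂)
  open import Data.Product using (_×_; _,_; proj₁)
  open import Data.Empty using (⊥-elim)
  open import Function using (_∘_)
  open import Data.Bool using (true; false)
  open import Relation.Unary using (Decidable)
  open import Relation.Nullary using (¬_; yes; no; does)
  open import Relation.Nullary.Decidable using (_×-dec_; ¬?)
  open import Relation.Binary.PropositionalEquality using (_≡_; _≢_; refl; sym; trans; cong; cong₂)

  count : {A : Set} {P : A → Set} → Decidable P → List A → ℕ
  count P? xs = length (filter P? xs)

  module _ {A : Set} {P : A → Set} (P? : Decidable P) where

    count-++ : (xs ys : List A) → count P? (xs ++ ys) ≡ count P? xs + count P? ys
    count-++ xs ys = trans (cong length (filter-++ P? xs ys)) (length-++ (filter P? xs))

    count-none : (xs : List A) → All (¬_ ∘ P) xs → count P? xs ≡ 0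
    count-none xs none = cong length (filter-none P? none)

    count-concatMap : {B : Set} (f : B → List A) (xs : List B) →
                      count P? (concatMap f xs) ≡ sum (map (count P? ∘ f) xs)
    count-concatMap f []       = refl
    count-concatMap f (x ∷ xs) = trans (count-++ (f x) (concatMap f xs))
                                       (cong (count P? (f x) +_) (count-concatMap f xs))

    count-map : {B : Set} (f : B → A) (xs : List B) → count P? (map f xs) ≡ count (P? ∘ f) xs
    count-map f []       = refl
    count-map f (x ∷ xs) with does (P? (f x))
    ... | true  = cong suc (count-map f xs)
    ... | false = count-map f xs

    count-cong : {Q : A → Set} (Q? : Decidable Q) → (∀ x → P x → Q x) → (∀ x → Q x → P x) →
                 (xs : List A) → count P? xs ≡ count Q? xs
    count-cong Q? P⇒Q Q⇒P []       = refl
    count-cong Q? P⇒Q Q⇒P (x ∷ xs) with P? x | Q? x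
    ... | yes _  | yes _  = cong suc (count-cong Q? P⇒Q Q⇒P xs)
    ... | yes p  | no ¬q  = ⊥-elim (¬q (P⇒Q x p))
    ... | no ¬p  | yes q  = ⊥-elim (¬p (Q⇒P x q))
    ... | no _   | no _   = count-cong Q? P⇒Q Q⇒P xs

    count-partition : {Q R : A → Set} (Q? : Decidable Q) (R? : Decidable R) →
                      (∀ x → P x → Q x ⊎ R x) → (∀ x → Q x → P x) → (∀ x → R x → P x) →
                      (∀ x → Q x → ¬ R x) → (xs : List A) → count P? xs ≡ count Q? xs + count R? xs
    count-partition Q? R? split Q⇒P R⇒P disjoint = go
      where
      go : (xs : List A) → count P? xs ≡ count Q? xs + count R? xs
      go []       = refl
      go (x ∷ xs) with P? x | Q? x | R? x
      ... | _     | yes q | yes r = ⊥-elim (disjoint x q r)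
      ... | yes _ | yes _ | no _  = cong suc (go xs)
      ... | yes _ | no _  | yes _ = trans (cong suc (go xs)) (sym (+-suc _ _))
      ... | yes p | no ¬q | no ¬r with split x p
      ...   | inj₁ q = ⊥-elim (¬q q)
      ...   | inj₂ r = ⊥-elim (¬r r)
      go (x ∷ xs) | no ¬p | yes q | no _  = ⊥-elim (¬p (Q⇒P x q))
      go (x ∷ xs) | no ¬p | no _  | yes r = ⊥-elim (¬p (R⇒P x r))
      go (x ∷ xs) | no _  | no _  | no _  = go xs

    count-split : {Q : A → Set} (Q? : Decidable Q) (xs : List A) →
                  count P? xs ≡ count (λ x → P? x ×-dec Q? x) xs + count (λ x → P? x ×-dec ¬? (Q? x)) xs
    count-split {Q} Q? = count-partition _ _ split (λ _ → proj₁) (λ _ → proj₁) (λ { x (_ , q) (_ , ¬q) → ¬q q })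
      where
      split : ∀ x → P x → (P x × Q x) ⊎ (P x × ¬ Q x)
      split x p with Q? x
      ... | yes q = inj₁ (p , q)
      ... | no ¬q = inj₂ (p , ¬q)

  sum-single : {A : Set} (f : A → ℕ) {j : A} {xs : List A} → Unique xs → j ∈ xs →
               (∀ x → x ≢ j → f x ≡ 0) → sum (map f xs) ≡ f j
  sum-single f (j∉xs ∷ _) (here refl) vanish =
    trans (cong (f _ +_) (vanishing (All.map (λ j≢x → vanish _ (j≢x ∘ sym)) j∉xs))) (+-identityʳ _)
    where
    vanishing : ∀ {ys} → All (λ y → f y ≡ 0) ys → sum (map f ys) ≡ 0
    vanishing []         = refl
    vanishing (fy≡0 ∷ r) = cong₂ _+_ fy≡0 (vanishing r)
  sum-single f {xs = x ∷ xs} (x∉xs ∷ unique) (there j∈xs) vanish =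
    trans (cong (_+ sum (map f xs)) (vanish x (All.lookup x∉xs j∈xs))) (sum-single f unique j∈xs vanish)

module Enumeration where
  open import Defs using (allVecs)
  open Counting
  open import Data.Nat using (ℕ; zero; suc; _+_; _<_)
  open import Data.Nat.Properties using (<-irrefl; +-identityʳ)
  open import Data.Nat.ListAction using (sum)
  open import Data.Nat.ListAction.Properties using (sum-++)
  open import Data.List using ([]; _∷_; [_]; map; upTo; _++_)
  open import Data.List.Properties using (map-cong; map-++; upTo-∷ʳ)
  open import Data.List.Relation.Unary.All as All using ([]; _∷_)
  open import Data.List.Relation.Unary.Unique.Propositional.Properties using (upTo⁺)
  open import Data.List.Membership.Propositional.Properties using (∈-upTo⁺)
  open import Data.Vec using (Vec; []; _∷_; _∷ʳ_; last; lookup)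
  open import Data.Fin using (zero; suc)
  open import Function using (_∘_)
  open import Relation.Unary using (Decidable)
  open import Relation.Binary.PropositionalEquality using (_≡_; refl; sym; trans; cong; cong₂; module ≡-Reasoning)
  open ≡-Reasoning

  last-∷ : ∀ {n} (y : ℕ) (e : Vec ℕ (suc n)) → last (y ∷ e) ≡ last e
  last-∷ y (z ∷ e) = refl

  count-allVecs-head : ∀ n b {P : Vec ℕ (suc n) → Set} (P? : Decidable P) →
    count P? (allVecs (suc n) b) ≡ sum (map (λ y → count (P? ∘ (y ∷_)) (allVecs n b)) (upTo b))
  count-allVecs-head n b P? =
    trans (count-concatMap P? (λ y → map (y ∷_) (allVecs n b)) (upTo b))
          (cong sum (map-cong (λ y → count-map P? (y ∷_) (allVecs n b)) (upTo b)))

  count-lastFixed : ∀ n b j {P : Vec ℕ (suc n) → Set} (P? : Decidable P) → j < b →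
    (∀ e → P e → last e ≡ j) → count P? (allVecs (suc n) b) ≡ count (P? ∘ (_∷ʳ j)) (allVecs n b)
  count-lastFixed zero b j P? j<b lastIsJ = begin
    count P? (allVecs 1 b)
      ≡⟨ count-allVecs-head zero b P? ⟩
    sum (map (λ y → count (P? ∘ (y ∷_)) (allVecs 0 b)) (upTo b))
      ≡⟨ sum-single _ (upTo⁺ b) (∈-upTo⁺ j<b)
           (λ x x≢j → count-none (P? ∘ (x ∷_)) _ ((λ p → x≢j (lastIsJ (x ∷ []) p)) ∷ [])) ⟩
    count (P? ∘ (j ∷_)) (allVecs 0 b)
      ≡⟨ count-cong (P? ∘ (j ∷_)) (P? ∘ (_∷ʳ j)) (λ { [] p → p }) (λ { [] p → p }) (allVecs 0 b) ⟩
    count (P? ∘ (_∷ʳ j)) (allVecs 0 b) ∎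
  count-lastFixed (suc n) b j P? j<b lastIsJ = begin
    count P? (allVecs (suc (suc n)) b)
      ≡⟨ count-allVecs-head (suc n) b P? ⟩
    sum (map (λ y → count (P? ∘ (y ∷_)) (allVecs (suc n) b)) (upTo b))
      ≡⟨ cong sum (map-cong (λ y → count-lastFixed n b j (P? ∘ (y ∷_)) j<b
                                     (λ e p → trans (sym (last-∷ y e)) (lastIsJ (y ∷ e) p))) (upTo b)) ⟩
    sum (map (λ y → count (P? ∘ (y ∷_) ∘ (_∷ʳ j)) (allVecs n b)) (upTo b))
      ≡⟨ count-allVecs-head n b (P? ∘ (_∷ʳ j)) ⟨
    count (P? ∘ (_∷ʳ j)) (allVecs (suc n) b) ∎

  count-bounded : ∀ n b {P : Vec ℕ n → Set} (P? : Decidable P) →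
    (∀ e → P e → ∀ i → lookup e i < b) → count P? (allVecs n (suc b)) ≡ count P? (allVecs n b)
  count-bounded zero    b P? bounded = refl
  count-bounded (suc n) b P? bounded = begin
    count P? (allVecs (suc n) (suc b))
      ≡⟨ count-allVecs-head n (suc b) P? ⟩
    sum (map (tail (suc b)) (upTo (suc b)))
      ≡⟨ cong (sum ∘ map (tail (suc b))) (upTo-∷ʳ b) ⟨
    sum (map (tail (suc b)) (upTo b ++ [ b ]))
      ≡⟨ cong sum (map-++ (tail (suc b)) (upTo b) [ b ]) ⟩
    sum (map (tail (suc b)) (upTo b) ++ [ tail (suc b) b ])
      ≡⟨ sum-++ (map (tail (suc b)) (upTo b)) [ tail (suc b) b ] ⟩
    sum (map (tail (suc b)) (upTo b)) + (tail (suc b) b + 0)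
      ≡⟨ cong₂ _+_ (cong sum (map-cong shrink (upTo b))) (cong (_+ 0) noTopEntry) ⟩
    sum (map (tail b) (upTo b)) + 0
      ≡⟨ +-identityʳ _ ⟩
    sum (map (tail b) (upTo b))
      ≡⟨ count-allVecs-head n b P? ⟨
    count P? (allVecs (suc n) b) ∎
    where
    tail : ℕ → ℕ → ℕ
    tail c y = count (P? ∘ (y ∷_)) (allVecs n c)
    shrink : ∀ y → tail (suc b) y ≡ tail b y
    shrink y = count-bounded n b (P? ∘ (y ∷_)) (λ e p i → bounded (y ∷ e) p (suc i))
    noTopEntry : tail (suc b) b ≡ 0
    noTopEntry = count-none (P? ∘ (b ∷_)) (allVecs n (suc b))
      (All.universal (λ e p → <-irrefl refl (bounded (b ∷ e) p zero)) (allVecs n (suc b)))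

module Appending where
  open import Defs
  open import Data.Nat using (ℕ; zero; suc; _<_; _≤_)
  open import Data.Nat.Properties using (≤-trans; <-trans)
  open import Data.Integer using (+_)
  open import Data.Vec using (Vec; []; _∷_; _∷ʳ_; last; lookup; toList; initLast)
  open import Data.Fin using (Fin; zero; suc; toℕ; fromℕ; inject₁)
  open import Data.Fin.Properties using (toℕ<n; toℕ-fromℕ; toℕ-inject₁)
  open import Data.Product using (_×_; _,_; proj₁)
  open import Data.Sum using (_⊎_; inj₁; inj₂; [_,_]; assocʳ; assocˡ; map₂)
  open import Function using (_∘_; id)
  open import Function.Bundles using (_⇔_; mk⇔; module Equivalence)
  open import Relation.Nullary using (¬_)
  open import Relation.Binary.PropositionalEquality using (_≡_; refl; sym; subst; subst₂)
  open Equivalence public using (to; from)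

  fin-elim-last : ∀ {n} {P : Fin (suc n) → Set} → (∀ i → P (inject₁ i)) → P (fromℕ n) → ∀ i → P i
  fin-elim-last {zero}  _     atLast zero    = atLast
  fin-elim-last {suc n} early _      zero    = early zero
  fin-elim-last {suc n} early atLast (suc i) = fin-elim-last (early ∘ suc) atLast i

  lookup-∷ʳ-inject₁ : ∀ {n} (q : Vec ℕ n) x i → lookup (q ∷ʳ x) (inject₁ i) ≡ lookup q i
  lookup-∷ʳ-inject₁ (y ∷ q) x zero    = refl
  lookup-∷ʳ-inject₁ (y ∷ q) x (suc i) = lookup-∷ʳ-inject₁ q x i

  lookup-∷ʳ-fromℕ : ∀ {n} (q : Vec ℕ n) x → lookup (q ∷ʳ x) (fromℕ n) ≡ x
  lookup-∷ʳ-fromℕ []      x = refl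
  lookup-∷ʳ-fromℕ (y ∷ q) x = lookup-∷ʳ-fromℕ q x

  last-lookup : ∀ {n} (q : Vec ℕ (suc n)) → last q ≡ lookup q (fromℕ n)
  last-lookup (y ∷ [])    = refl
  last-lookup (y ∷ z ∷ r) = last-lookup (z ∷ r)

  invSeq-∷ʳ : ∀ {n} (q : Vec ℕ n) x → IsInvSeq (q ∷ʳ x) ⇔ (IsInvSeq q × x < suc n)
  invSeq-∷ʳ {n} q x = mk⇔
    (λ inv → (λ i → subst₂ Entry (lookup-∷ʳ-inject₁ q x i) (toℕ-inject₁ i) (inv (inject₁ i)))
           , subst₂ Entry (lookup-∷ʳ-fromℕ q x) (toℕ-fromℕ n) (inv (fromℕ n)))
    (λ (inv , x<) → fin-elim-last {P = λ i → Entry (lookup (q ∷ʳ x) i) (toℕ i)}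
      (λ i → subst₂ Entry (sym (lookup-∷ʳ-inject₁ q x i)) (sym (toℕ-inject₁ i)) (inv i))
      (subst₂ Entry (sym (lookup-∷ʳ-fromℕ q x)) (sym (toℕ-fromℕ n)) x<))
    where
    Entry : ℕ → ℕ → Set
    Entry v t = v < suc t

  invSeq-bounded : ∀ {n} (e : Vec ℕ n) → IsInvSeq e → ∀ i → lookup e i < n
  invSeq-bounded e inv i = ≤-trans (inv i) (toℕ<n i)

  invSeq-last : ∀ {n} (q : Vec ℕ (suc n)) → IsInvSeq q → last q < suc n
  invSeq-last {n} q inv = subst (_< suc n) (sym (last-lookup q)) (invSeq-bounded q inv (fromℕ n))

  lastIs⇔ : ∀ {n} k (q : Vec ℕ (suc n)) → LastIs k (toList q) ⇔ (+ last q ≡ k)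
  lastIs⇔ k (y ∷ [])    = mk⇔ id id
  lastIs⇔ k (y ∷ z ∷ r) = lastIs⇔ k (z ∷ r)

  lastDesc-∷ʳ : ∀ {n} (q : Vec ℕ (suc n)) x → LastDesc (toList (q ∷ʳ x)) ⇔ (x < last q)
  lastDesc-∷ʳ (y ∷ [])        x = mk⇔ id id
  lastDesc-∷ʳ (y ∷ z ∷ [])    x = lastDesc-∷ʳ (z ∷ []) x
  lastDesc-∷ʳ (y ∷ z ∷ w ∷ r) x = lastDesc-∷ʳ (z ∷ w ∷ r) x

  occ-∷ʳ : ∀ {n} (q : Vec ℕ (suc n)) x →
           Occ (toList (q ∷ʳ x)) ⇔ (Occ (toList q) ⊎ (LastDesc (toList q) × x ≤ last q))
  occ-∷ʳ (y ∷ [])        x = mk⇔ (λ ()) [ (λ ()) , (λ ()) ∘ proj₁ ]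
  occ-∷ʳ (y ∷ z ∷ [])    x = mk⇔ [ inj₂ , (λ ()) ] [ (λ ()) , inj₁ ]
  occ-∷ʳ (y ∷ z ∷ w ∷ r) x = mk⇔ (assocˡ ∘ map₂ (to (occ-∷ʳ (z ∷ w ∷ r) x)))
                                  (map₂ (from (occ-∷ʳ (z ∷ w ∷ r) x)) ∘ assocʳ)

  inI-∷ʳ : ∀ {n} (q : Vec ℕ (suc n)) x →
           InI (q ∷ʳ x) ⇔ ((InI q × x < suc (suc n)) × ¬ (LastDesc (toList q) × x ≤ last q))
  inI-∷ʳ q x = mk⇔
    (λ (inv , avoids) → let invq , x< = to (invSeq-∷ʳ q x) inv in
      ((invq , avoids ∘ from (occ-∷ʳ q x) ∘ inj₁) , x<) , avoids ∘ from (occ-∷ʳ q x) ∘ inj₂)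
    (λ (((invq , avoidsq) , x<) , noDesc) →
      from (invSeq-∷ʳ q x) (invq , x<) , [ avoidsq , noDesc ] ∘ to (occ-∷ʳ q x))

  lastDesc-bound : ∀ {n} (e : Vec ℕ (suc n)) → IsInvSeq e → LastDesc (toList e) → last e < n
  lastDesc-bound {zero}  (y ∷ []) _ ()
  lastDesc-bound {suc n} e inv desc with initLast e
  ... | q , x , refl =  -- here `last e` has become x, as `last` is defined through initLast
    <-trans (to (lastDesc-∷ʳ q x) desc) (invSeq-last q (proj₁ (to (invSeq-∷ʳ q x) inv)))

module Refinements where
  open import Defs
  open Counting
  open Enumeration using (count-lastFixed; count-bounded)
  open Appending
  open import Data.Nat using (ℕ; suc; _+_; _<_; _≤_; s≤s; s≤s⁻¹)
  open import Data.Nat.Properties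
    using (_≟_; _≤?_; _<?_; ≤-refl; <-trans; <⇒≤; ≤-antisym; ≮⇒≥; ≤∧≢⇒<; <-irrefl; ≤-reflexive; ≤⇒≯; n<1+n; m<n⇒m<1+n; m≤n⇒m≤1+n)
  open import Data.Integer using (ℤ; +_)
  open import Data.Integer.Properties using (+-injective)
  open import Data.List using (List)
  open import Data.List.Relation.Unary.All using (universal)
  open import Data.Vec using (Vec; _∷ʳ_; last; toList)
  open import Data.Vec.Properties using (last-∷ʳ)
  open import Data.Product using (_×_; _,_; proj₁; proj₂)
  open import Data.Sum using (_⊎_; inj₁; inj₂)
  open import Function using (_∘_)
  open import Relation.Unary using (Decidable)
  open import Relation.Nullary using (¬_; yes; no)
  open import Relation.Nullary.Decidable using (_×-dec_; ¬?)
  open import Relation.Binary.PropositionalEquality using (_≡_; sym; trans; cong; subst)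

  EndsWith : ∀ {n} → ℤ → Vec ℕ n → Set
  EndsWith k e = InI e × LastIs k (toList e)

  endsWith? : ∀ {n} (k : ℤ) → Decidable (EndsWith {n} k)
  endsWith? k e = inI? e ×-dec lastIs? k (toList e)

  endsDesc? : ∀ {n} (k : ℤ) → Decidable (λ (e : Vec ℕ n) → EndsWith k e × LastDesc (toList e))
  endsDesc? k e = endsWith? k e ×-dec lastDesc? (toList e)

  endsAsc? : ∀ {n} (k : ℤ) → Decidable (λ (e : Vec ℕ n) → EndsWith k e × ¬ LastDesc (toList e))
  endsAsc? k e = endsWith? k e ×-dec ¬? (lastDesc? (toList e))

  lastEquals : ∀ {n} j (e : Vec ℕ (suc n)) → LastIs (+ j) (toList e) → last e ≡ j
  lastEquals j e = +-injective ∘ to (lastIs⇔ (+ j) e)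

  lastIs-∷ʳ : ∀ {n} j (q : Vec ℕ n) → LastIs (+ j) (toList (q ∷ʳ j))
  lastIs-∷ʳ j q = from (lastIs⇔ (+ j) (q ∷ʳ j)) (cong +_ (last-∷ʳ j q))

  aNK-split : ∀ n k → aNK n k ≡ aGtNK n k + count (endsAsc? k) (allVecs n n)
  aNK-split n k = count-split (endsWith? k) (lastDesc? ∘ toList) (allVecs n n)

  aNK-outside : ∀ n k → (∀ x → x ≤ n → ¬ + x ≡ k) → aNK (suc n) k ≡ 0
  aNK-outside n k excluded = count-none (endsWith? k) vectors (universal impossible vectors)
    where
    vectors : List (Vec ℕ (suc n))
    vectors = allVecs (suc n) (suc n)
    impossible : ∀ e → ¬ EndsWith k e
    impossible e ((inv , _) , ends) =
      excluded (last e) (s≤s⁻¹ (invSeq-last e inv)) (to (lastIs⇔ k e) ends)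

  aGtNK-outside : ∀ n k → (∀ x → x < n → ¬ + x ≡ k) → aGtNK (suc n) k ≡ 0
  aGtNK-outside n k excluded = count-none (endsDesc? k) vectors (universal impossible vectors)
    where
    vectors : List (Vec ℕ (suc n))
    vectors = allVecs (suc n) (suc n)
    impossible : ∀ e → ¬ (EndsWith k e × LastDesc (toList e))
    impossible e (((inv , _) , ends) , desc) =
      excluded (last e) (lastDesc-bound e inv desc) (to (lastIs⇔ k e) ends)

  count-byPrefix : ∀ n j {P : Vec ℕ (suc n) → Set} (P? : Decidable P) → j ≤ n →
    (∀ e → P e → IsInvSeq e) → (∀ e → P e → last e ≡ j) →
    count P? (allVecs (suc n) (suc n)) ≡ count (P? ∘ (_∷ʳ j)) (allVecs n n)
  count-byPrefix n j P? j≤n invSeq lastIsJ =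
    trans (count-lastFixed n (suc n) j P? (s≤s j≤n) lastIsJ)
          (count-bounded n n (P? ∘ (_∷ʳ j))
            (λ q p → invSeq-bounded q (proj₁ (to (invSeq-∷ʳ q j) (invSeq _ p)))))

  -- Sequences of length N = M + 1 through their prefixes of length M = m + 1.
  module Prefixes (m : ℕ) where

    prefixes : List (Vec ℕ (suc m))
    prefixes = allVecs (suc m) (suc m)

    -- q ∷ʳ j lies in I_N(>,≥): q does, and q does not end in a descent with q_M ≥ j.
    Extendable : ℕ → Vec ℕ (suc m) → Set
    Extendable j q = InI q × ¬ (LastDesc (toList q) × j ≤ last q)

    extendable? : ∀ j → Decidable (Extendable j)
    extendable? j q = inI? q ×-dec ¬? (lastDesc? (toList q) ×-dec (j ≤? last q))

    -- q ∷ʳ j lies in I_N(>,≥) and ends in a descent.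
    DescExtendable : ℕ → Vec ℕ (suc m) → Set
    DescExtendable j q = (InI q × ¬ LastDesc (toList q)) × j < last q

    descExtendable? : ∀ j → Decidable (DescExtendable j)
    descExtendable? j q = (inI? q ×-dec ¬? (lastDesc? (toList q))) ×-dec (j <? last q)

    aNK-extendable : ∀ j → j ≤ suc m → aNK (suc (suc m)) (+ j) ≡ count (extendable? j) prefixes
    aNK-extendable j j≤ =
      trans (count-byPrefix (suc m) j (endsWith? (+ j)) j≤ (λ _ → proj₁ ∘ proj₁) (λ e → lastEquals j e ∘ proj₂))
            (count-cong _ (extendable? j) extends restricts prefixes)
      where
      extends : ∀ q → EndsWith (+ j) (q ∷ʳ j) → Extendable j q
      extends q (inI , _) = let ((inIq , _) , noDesc) = to (inI-∷ʳ q j) inI in inIq , noDesc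
      restricts : ∀ q → Extendable j q → EndsWith (+ j) (q ∷ʳ j)
      restricts q (inIq , noDesc) = from (inI-∷ʳ q j) ((inIq , s≤s j≤) , noDesc) , lastIs-∷ʳ j q

    aGtNK-descExtendable : ∀ j → j ≤ suc m → aGtNK (suc (suc m)) (+ j) ≡ count (descExtendable? j) prefixes
    aGtNK-descExtendable j j≤ =
      trans (count-byPrefix (suc m) j (endsDesc? (+ j)) j≤
              (λ _ → proj₁ ∘ proj₁ ∘ proj₁) (λ e → lastEquals j e ∘ proj₂ ∘ proj₁))
            (count-cong _ (descExtendable? j) extends restricts prefixes)
      where
      extends : ∀ q → EndsWith (+ j) (q ∷ʳ j) × LastDesc (toList (q ∷ʳ j)) → DescExtendable j q
      extends q ((inI , _) , desc) =
        let ((inIq , _) , noDesc) = to (inI-∷ʳ q j) inI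
            j<last = to (lastDesc-∷ʳ q j) desc
        in (inIq , λ descq → noDesc (descq , <⇒≤ j<last)) , j<last
      restricts : ∀ q → DescExtendable j q → EndsWith (+ j) (q ∷ʳ j) × LastDesc (toList (q ∷ʳ j))
      restricts q ((inIq , noDescq) , j<last) =
        let j<N = m<n⇒m<1+n (<-trans j<last (invSeq-last q (proj₁ inIq)))
        in (from (inI-∷ʳ q j) ((inIq , j<N) , noDescq ∘ proj₁) , lastIs-∷ʳ j q) , from (lastDesc-∷ʳ q j) j<last

    -- Every prefix is extendable by M, since its last entry is below M.
    extendable-all : count (extendable? (suc m)) prefixes ≡ a (suc m)
    extendable-all = count-cong _ inI? (λ _ → proj₁) (λ q inIq → inIq , allowed q inIq) prefixes
      where
      allowed : ∀ q → InI q → ¬ (LastDesc (toList q) × suc m ≤ last q)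
      allowed q inIq (_ , M≤last) = ≤⇒≯ M≤last (invSeq-last q (proj₁ inIq))

    -- Raising j by one newly admits the prefixes ending in a descent with last entry j.
    extendable-step : ∀ j → count (extendable? (suc j)) prefixes
                          ≡ count (extendable? j) prefixes + aGtNK (suc m) (+ j)
    extendable-step j = count-partition _ (extendable? j) (endsDesc? (+ j)) split weaken lower disjoint prefixes
      where
      split : ∀ q → Extendable (suc j) q → Extendable j q ⊎ (EndsWith (+ j) q × LastDesc (toList q))
      split q (inIq , noDesc) with lastDesc? (toList q) ×-dec (j ≤? last q)
      ... | no  notDesc       = inj₁ (inIq , notDesc)
      ... | yes (desc , j≤last) =
        inj₂ ((inIq , from (lastIs⇔ (+ j) q) (cong +_ lastIsJ)) , desc)
        where
        lastIsJ : last q ≡ j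
        lastIsJ = ≤-antisym (≮⇒≥ (λ j<last → noDesc (desc , j<last))) j≤last
      weaken : ∀ q → Extendable j q → Extendable (suc j) q
      weaken q (inIq , noDesc) = inIq , λ (desc , j<last) → noDesc (desc , <⇒≤ j<last)
      lower : ∀ q → EndsWith (+ j) q × LastDesc (toList q) → Extendable (suc j) q
      lower q ((inIq , ends) , _) = inIq , λ (_ , j<last) → <-irrefl (sym (lastEquals j q ends)) j<last
      disjoint : ∀ q → Extendable j q → ¬ (EndsWith (+ j) q × LastDesc (toList q))
      disjoint q (_ , noDesc) ((_ , ends) , desc) = noDesc (desc , ≤-reflexive (sym (lastEquals j q ends)))

    -- Raising j by one loses the prefixes without final descent whose last entry is j+1.
    descExtendable-step : ∀ j → count (descExtendable? j) prefixes
                              ≡ count (descExtendable? (suc j)) prefixes + count (endsAsc? (+ suc j)) prefixes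
    descExtendable-step j =
      count-partition _ (descExtendable? (suc j)) (endsAsc? (+ suc j)) split raise atJ+1 disjoint prefixes
      where
      split : ∀ q → DescExtendable j q → DescExtendable (suc j) q ⊎ (EndsWith (+ suc j) q × ¬ LastDesc (toList q))
      split q ((inIq , noDesc) , j<last) with suc j ≟ last q
      ... | yes j+1≡last = inj₂ ((inIq , from (lastIs⇔ (+ suc j) q) (cong +_ (sym j+1≡last))) , noDesc)
      ... | no  j+1≢last = inj₁ ((inIq , noDesc) , ≤∧≢⇒< j<last j+1≢last)
      raise : ∀ q → DescExtendable (suc j) q → DescExtendable j q
      raise q (asc , j+1<last) = asc , <⇒≤ j+1<last
      atJ+1 : ∀ q → EndsWith (+ suc j) q × ¬ LastDesc (toList q) → DescExtendable j q
      atJ+1 q ((inIq , ends) , noDesc) =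
        (inIq , noDesc) , subst (j <_) (sym (lastEquals (suc j) q ends)) (n<1+n j)
      disjoint : ∀ q → DescExtendable (suc j) q → ¬ (EndsWith (+ suc j) q × ¬ LastDesc (toList q))
      disjoint q (_ , j+1<last) ((_ , ends) , _) = <-irrefl (sym (lastEquals (suc j) q ends)) j+1<last

    -- The recurrences of the proposition, over ℕ (N = m + 2, M = m + 1).
    aNK-top : aNK (suc (suc m)) (+ suc m) ≡ a (suc m)
    aNK-top = trans (aNK-extendable (suc m) ≤-refl) extendable-all

    aNK-step : ∀ j → j ≤ m → aNK (suc (suc m)) (+ suc j) ≡ aNK (suc (suc m)) (+ j) + aGtNK (suc m) (+ j)
    aNK-step j j≤m = trans (aNK-extendable (suc j) (s≤s j≤m))
      (trans (extendable-step j) (cong (_+ aGtNK (suc m) (+ j)) (sym (aNK-extendable j (m≤n⇒m≤1+n j≤m)))))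

    aGtNK-step : ∀ j → j ≤ m → aGtNK (suc (suc m)) (+ j)
                             ≡ aGtNK (suc (suc m)) (+ suc j) + count (endsAsc? (+ suc j)) prefixes
    aGtNK-step j j≤m = trans (aGtNK-descExtendable j (m≤n⇒m≤1+n j≤m))
      (trans (descExtendable-step j)
             (cong (_+ count (endsAsc? (+ suc j)) prefixes) (sym (aGtNK-descExtendable (suc j) (s≤s j≤m)))))

open import Defs
open import Data.Nat using (ℕ; _≥_; _∸_)
open import Data.Integer using (ℤ; +_; _+_; _-_; _≤_; _<_; 0ℤ; 1ℤ)
open import Data.Product using (_×_)
open import Relation.Nullary using (¬_)
open import Relation.Binary.PropositionalEquality using (_≡_)

open import Data.Nat using (zero; suc; z≤n; s≤s; s≤s⁻¹) renaming (_+_ to _+ℕ_; _≤_ to _≤ℕ_; _<_ to _<ℕ_)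
open import Data.Nat.Properties using (m≤n⇒m<n∨m≡n) renaming (+-comm to +ℕ-comm)
open import Data.Integer using (+≤+)
open import Data.Integer.Properties using (pos-+; <-irrefl)
open import Data.Integer.Solver using (module +-*-Solver)
open import Data.Product using (_,_)
open import Data.Sum using (inj₁; inj₂)
open import Relation.Binary.PropositionalEquality using (refl; sym; trans; cong; subst; module ≡-Reasoning)
open Counting using (count)
open Refinements
open +-*-Solver
open ≡-Reasoning

difference : ∀ x c → + x ≡ + (x +ℕ c) - + c
difference x c rewrite pos-+ x c = solve 2 (λ x c → x := (x :+ c) :- c) refl (+ x) (+ c)

difference-shift : ∀ y z c → + (y +ℕ c) ≡ (+ y - + z) + + (z +ℕ c)
difference-shift y z c rewrite pos-+ y c | pos-+ z c =
  solve 3 (λ y z c → y :+ c := (y :- z) :+ (z :+ c)) refl (+ y) (+ z) (+ c)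

plus-one : ∀ j → + j + 1ℤ ≡ + suc j
plus-one j = cong +_ (+ℕ-comm j 1)

module _ (m : ℕ) where
  open Prefixes m using (prefixes; aNK-step; aGtNK-step)

  -- In the notation of the proposition, n = m + 2, n ∸ 1 = m + 1 and n ∸ 2 = m.
  aNK-recurrence : ∀ j → j ≤ℕ m →
    + aNK (suc (suc m)) (+ j) ≡ + aNK (suc (suc m)) (+ j + 1ℤ) - + aGtNK (suc m) (+ j)
  aNK-recurrence j j≤m = begin
    + aNK (suc (suc m)) (+ j)
      ≡⟨ difference _ (aGtNK (suc m) (+ j)) ⟩
    + (aNK (suc (suc m)) (+ j) +ℕ aGtNK (suc m) (+ j)) - + aGtNK (suc m) (+ j)
      ≡⟨ cong (λ x → + x - + aGtNK (suc m) (+ j)) (aNK-step j j≤m) ⟨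
    + aNK (suc (suc m)) (+ suc j) - + aGtNK (suc m) (+ j)
      ≡⟨ cong (λ k → + aNK (suc (suc m)) k - + aGtNK (suc m) (+ j)) (plus-one j) ⟨
    + aNK (suc (suc m)) (+ j + 1ℤ) - + aGtNK (suc m) (+ j) ∎

  aGtNK-recurrence : ∀ j → j ≤ℕ m →
    + aGtNK (suc (suc m)) (+ j)
      ≡ (+ aGtNK (suc (suc m)) (+ j + 1ℤ) - + aGtNK (suc m) (+ j + 1ℤ)) + + aNK (suc m) (+ j + 1ℤ)
  aGtNK-recurrence j j≤m = begin
    + aGtNK (suc (suc m)) (+ j)
      ≡⟨ cong +_ (aGtNK-step j j≤m) ⟩
    + (aGtNK (suc (suc m)) (+ suc j) +ℕ ascending)
      ≡⟨ difference-shift _ (aGtNK (suc m) (+ suc j)) ascending ⟩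
    (+ aGtNK (suc (suc m)) (+ suc j) - + aGtNK (suc m) (+ suc j)) + + (aGtNK (suc m) (+ suc j) +ℕ ascending)
      ≡⟨ cong (λ x → (+ aGtNK (suc (suc m)) (+ suc j) - + aGtNK (suc m) (+ suc j)) + + x)
              (aNK-split (suc m) (+ suc j)) ⟨
    (+ aGtNK (suc (suc m)) (+ suc j) - + aGtNK (suc m) (+ suc j)) + + aNK (suc m) (+ suc j)
      ≡⟨ cong (λ k → (+ aGtNK (suc (suc m)) k - + aGtNK (suc m) k) + + aNK (suc m) k) (plus-one j) ⟨
    (+ aGtNK (suc (suc m)) (+ j + 1ℤ) - + aGtNK (suc m) (+ j + 1ℤ)) + + aNK (suc m) (+ j + 1ℤ) ∎
    where
    ascending : ℕ
    ascending = count (endsAsc? (+ suc j)) prefixes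

  aNK-vanishes : ∀ k → ¬ k ≡ + suc m → ¬ (0ℤ ≤ k × k ≤ + m) → aNK (suc (suc m)) k ≡ 0
  aNK-vanishes k notTop notInRange = aNK-outside (suc m) k excluded
    where
    excluded : ∀ x → x ≤ℕ suc m → ¬ + x ≡ k
    excluded x x≤ x≡k with m≤n⇒m<n∨m≡n x≤
    ... | inj₁ x<M = notInRange (subst (0ℤ ≤_) x≡k (+≤+ z≤n) , subst (_≤ + m) x≡k (+≤+ (s≤s⁻¹ x<M)))
    ... | inj₂ x≡M = notTop (trans (sym x≡k) (cong +_ x≡M))

  aGtNK-vanishes : ∀ k → ¬ (0ℤ ≤ k × k ≤ + m) → aGtNK (suc (suc m)) k ≡ 0
  aGtNK-vanishes k notInRange = aGtNK-outside (suc m) k excluded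
    where
    excluded : ∀ x → x <ℕ suc m → ¬ + x ≡ k
    excluded x x<M x≡k = notInRange (subst (0ℤ ≤_) x≡k (+≤+ z≤n) , subst (_≤ + m) x≡k (+≤+ (s≤s⁻¹ x<M)))

-- Initial conditions: the only sequence of length 1 is 0, with no descent.
aNK-one : ∀ k → 0ℤ < k → aNK 1 k ≡ 0
aNK-one k 0<k = aNK-outside 0 k λ { .0 z≤n 0≡k → <-irrefl 0≡k 0<k }

aGtNK-one : ∀ k → aGtNK 1 k ≡ 0
aGtNK-one k = aGtNK-outside 0 k λ _ ()

proposition4p28 :
    ((n : ℕ) → n ≥ 2 → (k : ℤ) →
      (k ≡ + (n ∸ 1) → + aNK n k ≡ + a (n ∸ 1))
      × (0ℤ ≤ k → k ≤ + (n ∸ 2) → + aNK n k ≡ + aNK n (k + 1ℤ) - + aGtNK (n ∸ 1) k)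
      × (¬ k ≡ + (n ∸ 1) → ¬ (0ℤ ≤ k × k ≤ + (n ∸ 2)) → aNK n k ≡ 0)
      × (0ℤ ≤ k → k ≤ + (n ∸ 2) →
          + aGtNK n k ≡ (+ aGtNK n (k + 1ℤ) - + aGtNK (n ∸ 1) (k + 1ℤ)) + + aNK (n ∸ 1) (k + 1ℤ))
      × (¬ (0ℤ ≤ k × k ≤ + (n ∸ 2)) → aGtNK n k ≡ 0))
    × a 1 ≡ 1
    × aNK 1 0ℤ ≡ 1
    × ((k : ℤ) → 0ℤ < k → aNK 1 k ≡ 0)
    × ((k : ℤ) → aGtNK 1 k ≡ 0)
proposition4p28 =
    (λ { zero () _
       ; (suc zero) (s≤s ()) _
       ; (suc (suc m)) _ k →
             (λ { refl → cong +_ (Prefixes.aNK-top m) })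
           , (λ { (+≤+ _) (+≤+ j≤m) → aNK-recurrence m _ j≤m })
           , aNK-vanishes m k
           , (λ { (+≤+ _) (+≤+ j≤m) → aGtNK-recurrence m _ j≤m })
           , aGtNK-vanishes m k })
  , refl , refl , aNK-one , aGtNK-one
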